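{- Let $\mathit{cs}$ be a constant specification and $A$ a justification formula with $\mathsf{J}^+_{\mathit{cs}}\vdash A$. Then for any substitution $\sigma=[h_1/x_{i_1},\dots,h_n/x_{i_n},t_1/y_{j_1},\dots,t_m/y_{j_m}]$, where $h_1,\dots,h_n$ are first-sort terms and $t_1,\dots,t_m$ second-sort terms, we have $\mathsf{J}^+_{\sigma(\mathit{cs})}\vdash\sigma(A)$. In particular, if $A$ has an injective proof in $\mathsf{J}^+$, then so does $\sigma(A)$.
   Context: Justification terms of two sorts are built simultaneously from first-sort variables $x_0,x_1,\dots$, second-sort variables $y_0,y_1,\dots$ and second-sort constants $c_0,c_1,\dots$: first-sort $w::=x_i\mid(w\cdot w)\mid\mathsf{head}(s)\mid\mathsf{tail}(s)\mid(w+w)$; second-sort $s::=y_i\mid c_i\mid(s\cdot s)\mid\mathsf{ind}(w,s)\mid(s+s)$. Formulas: $A::=p_i\mid\bot\mid(A\to A)\mid[w]A\mid[s]_{\mathsf{tc}}A$; $\neg A:=A\to\bot$, $A\wedge B:=\neg(A\to\neg B)$, $A\vee B:=\neg A\to B$. $\mathsf{J}^+_0$ has the rule modus ponens and axioms (for all formulas $A,B,C$, first-sort $h,w$, second-sort $t,s$): (i) $A\to(B\to A)$; (ii) $(A\to(B\to C))\to((A\to B)\to(A\to C))$; (iii) $\neg\neg A\to A$; (iv) $[h](A\to B)\to([w]A\to[h\cdot w]B)$; (v) $[h]A\vee[w]A\to[h+w]A$; (vi) $[t]_{\mathsf{tc}}(A\to B)\to([s]_{\mathsf{tc}}A\to[t\cdot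 s]_{\mathsf{tc}}B)$; (vii) $[s]_{\mathsf{tc}}A\to[\mathsf{head}(s)]A$; (viii) $[s]_{\mathsf{tc}}A\to[\mathsf{tail}(s)][s]_{\mathsf{tc}}A$; (ix) $[w]A\wedge[s]_{\mathsf{tc}}(A\to[w]A)\to[\mathsf{ind}(w,s)]_{\mathsf{tc}}A$; (x) $[t]_{\mathsf{tc}}A\vee[s]_{\mathsf{tc}}A\to[t+s]_{\mathsf{tc}}A$. A constant specification is a set of formulas $[c]_{\mathsf{tc}}A$ with $c$ a constant and $A$ an axiom of $\mathsf{J}^+_0$; $\mathsf{J}^+_{\mathit{cs}}$ is $\mathsf{J}^+_0$ with the members of $\mathit{cs}$ added as axioms; $\mathsf{J}^+$ is $\mathsf{J}^+_{\mathit{cs}}$ for $\mathit{cs}$ the set of all such formulas. A substitution replaces the listed variables simultaneously by the given terms; $\sigma(\mathit{cs})=\{\sigma(C)\mid C\in\mathit{cs}\}$. For a proof $\pi$ in $\mathsf{J}^+$, $\mathit{cs}(\pi)$ is the set of axioms of the form $[c]_{\mathsf{tc}}A$ occurring in $\pi$; $\pi$ is injective if $[c]_{\mathsf{tc}}A,[c]_{\mathsf{tc}}B\in\mathit{cs}(\pi)$ implies $A=B$. -}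

module Defs where

open import Data.Nat using (ℕ; _≟_)
open import Data.List using (List; []; _∷_; map)
open import Data.Product using (Σ; _×_; _,_; proj₁)
open import Relation.Nullary using (yes; no)
open import Relation.Binary.PropositionalEquality using (_≡_)
open import Data.List.Relation.Unary.Unique.Propositional using (Unique)

data Tm₁ : Set
data Tm₂ : Set

data Tm₁ where
  x    : ℕ → Tm₁
  _·₁_ : Tm₁ → Tm₁ → Tm₁
  head : Tm₂ → Tm₁
  tail : Tm₂ → Tm₁
  _+₁_ : Tm₁ → Tm₁ → Tm₁

data Tm₂ where
  y    : ℕ → Tm₂
  c    : ℕ → Tm₂
  _·₂_ : Tm₂ → Tm₂ → Tm₂
  ind  : Tm₁ → Tm₂ → Tm₂
  _+₂_ : Tm₂ → Tm₂ → Tm₂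

data Fm : Set where
  p     : ℕ → Fm
  ⊥'    : Fm
  _⇒_   : Fm → Fm → Fm
  [_]_  : Tm₁ → Fm → Fm
  [_]tc_ : Tm₂ → Fm → Fm

infixr 5 _⇒_

~_ : Fm → Fm
~ A = A ⇒ ⊥'

_∧'_ : Fm → Fm → Fm
A ∧' B = ~ (A ⇒ ~ B)

_∨'_ : Fm → Fm → Fm
A ∨' B = ~ A ⇒ B

data Ax : Fm → Set where
  ax1  : ∀ A B → Ax (A ⇒ (B ⇒ A))
  ax2  : ∀ A B C → Ax ((A ⇒ (B ⇒ C)) ⇒ ((A ⇒ B) ⇒ (A ⇒ C)))
  ax3  : ∀ A → Ax (~ (~ A) ⇒ A)
  ax4  : ∀ A B h w → Ax (([ h ] (A ⇒ B)) ⇒ (([ w ] A) ⇒ ([ h ·₁ w ] B)))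
  ax5  : ∀ A h w → Ax ((([ h ] A) ∨' ([ w ] A)) ⇒ ([ h +₁ w ] A))
  ax6  : ∀ A B t s → Ax (([ t ]tc (A ⇒ B)) ⇒ (([ s ]tc A) ⇒ ([ t ·₂ s ]tc B)))
  ax7  : ∀ A s → Ax (([ s ]tc A) ⇒ ([ head s ] A))
  ax8  : ∀ A s → Ax (([ s ]tc A) ⇒ ([ tail s ] ([ s ]tc A)))
  ax9  : ∀ A w s → Ax ((([ w ] A) ∧' ([ s ]tc (A ⇒ [ w ] A))) ⇒ ([ ind w s ]tc A))
  ax10 : ∀ A t s → Ax ((([ t ]tc A) ∨' ([ s ]tc A)) ⇒ ([ t +₂ s ]tc A))

FmSet : Set₁
FmSet = Fm → Set

IsCS : FmSet → Set
IsCS cs = ∀ F → cs F → Σ ℕ λ i → Σ Fm λ A → (F ≡ ([ c i ]tc A)) × Ax A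

-- The maximal constant specification (used for J⁺)
CSall : FmSet
CSall F = Σ ℕ λ i → Σ Fm λ A → (F ≡ ([ c i ]tc A)) × Ax A

data Proof (cs : FmSet) : Fm → Set where
  axiom : ∀ {A} → Ax A → Proof cs A
  csax  : ∀ {A} → cs A → Proof cs A
  mp    : ∀ {A B} → Proof cs (A ⇒ B) → Proof cs A → Proof cs B

_⊢_ : FmSet → Fm → Set
cs ⊢ A = Proof cs A

data CSOcc {cs : FmSet} : ∀ {A} → Proof cs A → Fm → Set where
  here  : ∀ {A} (h : cs A) → CSOcc (csax h) A
  mpˡ   : ∀ {A B F} {π₁ : Proof cs (A ⇒ B)} {π₂ : Proof cs A} →
          CSOcc π₁ F → CSOcc (mp π₁ π₂) F
  mpʳ   : ∀ {A B F} {π₁ : Proof cs (A ⇒ B)} {π₂ : Proof cs A} →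
          CSOcc π₂ F → CSOcc (mp π₁ π₂) F

Injective : ∀ {cs A} → Proof cs A → Set
Injective π = ∀ i A B → CSOcc π ([ c i ]tc A) → CSOcc π ([ c i ]tc B) → A ≡ B

HasInjProof : Fm → Set
HasInjProof A = Σ (Proof CSall A) Injective

record Subst : Set where
  constructor subst
  field
    sub₁ : List (ℕ × Tm₁)
    sub₂ : List (ℕ × Tm₂)
open Subst public

WellFormed : Subst → Set
WellFormed σ = Unique (map proj₁ (sub₁ σ)) × Unique (map proj₁ (sub₂ σ))

lookup₁ : List (ℕ × Tm₁) → ℕ → Tm₁
lookup₁ [] i = x i
lookup₁ ((j , h) ∷ l) i with i ≟ j
... | yes _ = h
... | no _ = lookup₁ l i

lookup₂ : List (ℕ × Tm₂) → ℕ → Tm₂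
lookup₂ [] i = y i
lookup₂ ((j , t) ∷ l) i with i ≟ j
... | yes _ = t
... | no _ = lookup₂ l i

substT₁ : Subst → Tm₁ → Tm₁
substT₂ : Subst → Tm₂ → Tm₂
substT₁ σ (x i) = lookup₁ (sub₁ σ) i
substT₁ σ (a ·₁ b) = substT₁ σ a ·₁ substT₁ σ b
substT₁ σ (head s) = head (substT₂ σ s)
substT₁ σ (tail s) = tail (substT₂ σ s)
substT₁ σ (a +₁ b) = substT₁ σ a +₁ substT₁ σ b
substT₂ σ (y i) = lookup₂ (sub₂ σ) i
substT₂ σ (c i) = c i
substT₂ σ (a ·₂ b) = substT₂ σ a ·₂ substT₂ σ b
substT₂ σ (ind w s) = ind (substT₁ σ w) (substT₂ σ s)
substT₂ σ (a +₂ b) = substT₂ σ a +₂ substT₂ σ b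

substF : Subst → Fm → Fm
substF σ (p i) = p i
substF σ ⊥' = ⊥'
substF σ (A ⇒ B) = substF σ A ⇒ substF σ B
substF σ ([ w ] A) = [ substT₁ σ w ] substF σ A
substF σ ([ s ]tc A) = [ substT₂ σ s ]tc substF σ A

substCS : Subst → FmSet → FmSet
substCS σ cs F = Σ Fm λ C → cs C × (F ≡ substF σ C)

{-# OPTIONS --safe #-}
module Submission where

-- Substitution commutes with every formula and term constructor and fixes the
-- constants, so it maps each axiom instance to an instance of the same scheme and
-- each specification axiom [c]A to [c]σ(A); applied to every leaf of a derivation
-- it therefore yields a derivation of σ(A) from σ(cs). Every specification axiom
-- occurring in the image of π is the image of one occurring in π under the same
-- constant, so injectivity of π carries over.

open import Defs
open import Data.Product using (Σ; _×_; _,_)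
open import Relation.Binary.PropositionalEquality using (_≡_; refl; cong)

Ax-subst : ∀ σ {A} → Ax A → Ax (substF σ A)
Ax-subst σ (ax1 A B)      = ax1 _ _
Ax-subst σ (ax2 A B C)    = ax2 _ _ _
Ax-subst σ (ax3 A)        = ax3 _
Ax-subst σ (ax4 A B h w)  = ax4 _ _ _ _
Ax-subst σ (ax5 A h w)    = ax5 _ _ _
Ax-subst σ (ax6 A B t s)  = ax6 _ _ _ _
Ax-subst σ (ax7 A s)      = ax7 _ _
Ax-subst σ (ax8 A s)      = ax8 _ _
Ax-subst σ (ax9 A w s)    = ax9 _ _ _
Ax-subst σ (ax10 A t s)   = ax10 _ _ _

SubstInto : Subst → FmSet → FmSet → Set
SubstInto σ cs cs' = ∀ F → cs F → cs' (substF σ F)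

SubstInto-substCS : ∀ σ cs → SubstInto σ cs (substCS σ cs)
SubstInto-substCS σ cs F F∈cs = F , F∈cs , refl

SubstInto-CSall : ∀ σ → SubstInto σ CSall CSall
SubstInto-CSall σ _ (i , A , refl , isAx) = i , substF σ A , refl , Ax-subst σ isAx

IsCS-CSall : IsCS CSall
IsCS-CSall _ F∈CSall = F∈CSall

⊢-subst : ∀ σ {cs cs' : FmSet} → SubstInto σ cs cs' →
          ∀ {A} → cs ⊢ A → cs' ⊢ substF σ A
⊢-subst σ f (axiom isAx) = axiom (Ax-subst σ isAx)
⊢-subst σ f (csax F∈cs)  = csax (f _ F∈cs)
⊢-subst σ f (mp π₁ π₂)   = mp (⊢-subst σ f π₁) (⊢-subst σ f π₂)

CSOcc⇒∈ : ∀ {cs A F} {π : cs ⊢ A} → CSOcc π F → cs F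
CSOcc⇒∈ (here F∈cs) = F∈cs
CSOcc⇒∈ (mpˡ occ)   = CSOcc⇒∈ occ
CSOcc⇒∈ (mpʳ occ)   = CSOcc⇒∈ occ

CSOcc-⊢-subst⁻ : ∀ σ {cs cs' : FmSet} (f : SubstInto σ cs cs') →
                 ∀ {A} (π : cs ⊢ A) {F} → CSOcc (⊢-subst σ {cs} {cs'} f π) F →
                 Σ Fm λ G → CSOcc π G × F ≡ substF σ G
CSOcc-⊢-subst⁻ σ f (csax F∈cs) (here _) = _ , here F∈cs , refl
CSOcc-⊢-subst⁻ σ f (mp π₁ π₂) (mpˡ occ) with CSOcc-⊢-subst⁻ σ f π₁ occ
... | G , occ' , F≡σG = G , mpˡ occ' , F≡σG
CSOcc-⊢-subst⁻ σ f (mp π₁ π₂) (mpʳ occ) with CSOcc-⊢-subst⁻ σ f π₂ occ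
... | G , occ' , F≡σG = G , mpʳ occ' , F≡σG

Injective-⊢-subst : ∀ σ {cs cs' : FmSet} → IsCS cs → (f : SubstInto σ cs cs') →
                    ∀ {A} (π : cs ⊢ A) → Injective π → Injective (⊢-subst σ {cs} {cs'} f π)
Injective-⊢-subst σ isCS f π inj i A' B' occ₁ occ₂
  with CSOcc-⊢-subst⁻ σ f π occ₁ | CSOcc-⊢-subst⁻ σ f π occ₂
... | G , occG , e₁ | H , occH , e₂
  with isCS G (CSOcc⇒∈ occG) | isCS H (CSOcc⇒∈ occH)
... | _ , A , refl , _ | _ , B , refl , _
  with e₁ | e₂
... | refl | refl = cong (substF σ) (inj i A B occG occH)

mainTheorem4 : (∀ (cs : FmSet) → IsCS cs → ∀ A → cs ⊢ A →
                    ∀ (σ : Subst) → WellFormed σ → substCS σ cs ⊢ substF σ A)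
                 × (∀ A → HasInjProof A → ∀ (σ : Subst) → WellFormed σ → HasInjProof (substF σ A))
mainTheorem4 =
    (λ cs _ A π σ _ → ⊢-subst σ (SubstInto-substCS σ cs) π)
  , λ A (π , inj) σ _ →
      ⊢-subst σ (SubstInto-CSall σ) π , Injective-⊢-subst σ IsCS-CSall (SubstInto-CSall σ) π inj
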